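{- For every positive integer $n$, the general position number of the $n$-dimensional integer lattice graph $P_\infty^n$ equals $2^{2^{n-1}}$, i.e. ${\rm gp}(P_\infty^n) = 2^{2^{n-1}}$.
   Context: For a connected graph $G$ with shortest-path distance $d_G$, a set $S\subseteq V(G)$ is a general position set if $d_G(u,v)\neq d_G(u,w)+d_G(w,v)$ for every three pairwise distinct vertices $u,v,w\in S$ (i.e. no three vertices of $S$ lie on a common geodesic). The general position number ${\rm gp}(G)$ is the maximum cardinality of a general position set of $G$. $P_\infty$ is the two-way infinite path with vertex set $\mathbb{Z}$, where $u,v$ are adjacent iff $|u-v|=1$. $P_\infty^n$ is the Cartesian product of $n$ copies of $P_\infty$: vertex set $\mathbb{Z}^n$, two vertices adjacent iff they differ in exactly one coordinate and by exactly $1$ there. Equivalently, the distance is $d(u,v)=\sum_{i=1}^n |u_i-v_i|$. -}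

module Defs where

open import Data.Nat using (ℕ; _+_; _≤_; _^_; _∸_)
open import Data.Integer using (ℤ; ∣_∣) renaming (_-_ to _-ℤ_)
open import Data.Vec using (Vec; []; _∷_)
open import Data.List using (List; length)
open import Data.List.Membership.Propositional using (_∈_)
open import Data.List.Relation.Unary.All using (All)
open import Data.List.Relation.Unary.Unique.Propositional using (Unique)
open import Data.Product using (Σ; _×_)
open import Relation.Binary.PropositionalEquality using (_≡_)
open import Relation.Nullary using (¬_)

Point : ℕ → Set
Point n = Vec ℤ n

-- Shortest-path distance of P_∞^n : d(u,v) = Σ_i |u_i - v_i|
dist : ∀ {n} → Point n → Point n → ℕ
dist [] [] = 0
dist (x ∷ xs) (y ∷ ys) = ∣ x -ℤ y ∣ + dist xs ys

IsGPSet : ∀ {n} → (Point n → Set) → Set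
IsGPSet {n} S = ∀ (u v w : Point n) → S u → S v → S w →
  ¬ (u ≡ v) → ¬ (u ≡ w) → ¬ (v ≡ w) →
  ¬ (dist u v ≡ dist u w + dist w v)

-- gp(P_∞^n) = N : some general position set has exactly N elements, and every
-- general position set (possibly infinite) has no N+1 distinct elements.
GPNumberIs : ℕ → ℕ → Set₁
GPNumberIs n N =
  Σ (List (Point n)) (λ xs → Unique xs × IsGPSet (λ p → p ∈ xs) × length xs ≡ N)
  × (∀ (S : Point n → Set) → IsGPSet S →
       ∀ (xs : List (Point n)) → Unique xs → All S xs → length xs ≤ N)

-- Upper bound: order ℤⁿ by the 2ⁿ⁻¹ orthant orders that increase the first coordinate;
-- any two points are comparable in one of them, and a general position set contains no
-- chain of three points in any of them (a monotone chain is a geodesic). Labelling each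
-- point by the set of orders in which it lies strictly above another point is therefore
-- injective, so there are at most 2^(2ⁿ⁻¹) points.
--
-- Lower bound: from a configuration f of N points in ℕⁿ in general position, with
-- coordinates below N and injective first coordinate, build N² points in ℕⁿ⁺¹ indexed
-- by pairs (a , b): the coordinates of f a and f b become the high and low digits in
-- base N, and a new first coordinate takes the high digit from f a and the reflected
-- low digit N − 1 − (f b)₀. Three points in one row are separated by the low digits,
-- three in distinct rows by the high digits, and the reflected digit separates two points
-- of one row from a point of another. Starting from {0 , 1} ⊂ ℕ¹ this squares the size
-- n − 1 times.

module Submission where

open import Defs
open import Data.Empty using (⊥)
open import Data.Fin using (Fin; zero; suc; toℕ; remQuot; combine; funToFin; finToFun)
import Data.Fin.Properties as Finₚ
open import Data.Integer as ℤ using (ℤ; +_)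
import Data.Integer.Properties as ℤₚ
open import Data.Integer.Tactic.RingSolver using (solve-∀)
open import Data.List as List using (List; length)
open import Data.List.Membership.Propositional using (_∈_)
open import Data.List.Membership.Propositional.Properties using (∈-tabulate⁻; ∈-lookup)
open import Data.List.Properties using (length-tabulate)
open import Data.List.Relation.Unary.All as All using (All)
open import Data.List.Relation.Unary.AllPairs using (_∷_)
open import Data.List.Relation.Unary.Unique.Propositional using (Unique)
open import Data.List.Relation.Unary.Unique.Propositional.Properties using (tabulate⁺)
open import Data.Nat using (ℕ; zero; suc; _+_; _*_; _∸_; _^_; _≤_; _<_; z≤n; s≤s; z<s; ∣_-_∣)
import Data.Nat.Properties as ℕₚ
open import Algebra.Properties.CommutativeSemigroup ℕₚ.+-commutativeSemigroup using (interchange)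
open import Data.Product as Product using (_×_; _,_; proj₁; proj₂; ∃-syntax)
open import Data.Sum as Sum using (_⊎_; inj₁; inj₂)
open import Data.Vec as Vec using ([]; _∷_)
open import Data.Vec.Functional using (Vector; head; tail)
open import Function using (_∘_)
open import Function.Definitions using (Injective)
open import Level using (0ℓ)
open import Relation.Binary using (Rel; Decidable; tri<; tri≈; tri>)
open import Relation.Binary.PropositionalEquality
open import Relation.Nullary using (¬_; Dec; yes; no; ¬?; contradiction)
open import Relation.Nullary.Decidable using (_×-dec_)

ChainFree : ∀ {A : Set} → Rel A 0ℓ → Set
ChainFree R = ∀ {x y z} → x ≢ y → y ≢ z → R x y → R y z → ⊥

indicator : ∀ {P : Set} → Dec P → Fin 2
indicator (yes _) = suc zero
indicator (no _)  = zero

indicator-≢ : ∀ {P Q : Set} → ¬ P → Q → (p : Dec P) (q : Dec Q) → indicator p ≢ indicator q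
indicator-≢ ¬p _ (yes p) _      = contradiction p ¬p
indicator-≢ _  _ (no _) (yes _) = λ ()
indicator-≢ _  q (no _) (no ¬q) = contradiction q ¬q

module _ {K n : ℕ} (R : Fin K → Rel (Fin n) 0ℓ) (R? : ∀ c → Decidable (R c))
         (chainFree : ∀ c → ChainFree (R c))
         (comparable : ∀ {i j} → i ≢ j → ∃[ c ] (R c i j ⊎ R c j i)) where

  private
    HasStrictPredecessor : Fin K → Fin n → Set
    HasStrictPredecessor c j = ∃[ i ] (i ≢ j × R c i j)

    hasStrictPredecessor? : ∀ c j → Dec (HasStrictPredecessor c j)
    hasStrictPredecessor? c j = Finₚ.any? λ i → ¬? (i Finₚ.≟ j) ×-dec R? c i j

    bits : Fin n → Fin K → Fin 2
    bits j c = indicator (hasStrictPredecessor? c j)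

    bits-separate : ∀ {c i j} → i ≢ j → R c i j → bits i c ≢ bits j c
    bits-separate {c} {i} {j} i≢j Rij =
      indicator-≢ (λ (h , h≢i , Rhi) → chainFree c h≢i i≢j Rhi Rij) (i , i≢j , Rij)
        (hasStrictPredecessor? c i) (hasStrictPredecessor? c j)

    label : Fin n → Fin (2 ^ K)
    label j = funToFin (bits j)

    bits-agree : ∀ {i j} → label i ≡ label j → ∀ c → bits i c ≡ bits j c
    bits-agree {i} {j} eq c = begin
      bits i c              ≡⟨ Finₚ.finToFun-funToFin (bits i) c ⟨
      finToFun (label i) c  ≡⟨ cong (λ l → finToFun l c) eq ⟩
      finToFun (label j) c  ≡⟨ Finₚ.finToFun-funToFin (bits j) c ⟩
      bits j c              ∎
      where open ≡-Reasoning

    label-injective : Injective _≡_ _≡_ label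
    label-injective {i} {j} eq with i Finₚ.≟ j
    ... | yes i≡j = i≡j
    ... | no i≢j with comparable i≢j
    ...   | c , inj₁ Rij = contradiction (bits-agree eq c) (bits-separate i≢j Rij)
    ...   | c , inj₂ Rji = contradiction (sym (bits-agree eq c)) (bits-separate (i≢j ∘ sym) Rji)

  chainFreeCover⇒≤2^ : n ≤ 2 ^ K
  chainFreeCover⇒≤2^ = Finₚ.injective⇒≤ label-injective

_≤[_]_ : ℤ → Fin 2 → ℤ → Set
a ≤[ zero ]  b = a ℤ.≤ b
a ≤[ suc _ ] b = b ℤ.≤ a

_≤[_]?_ : ∀ a s b → Dec (a ≤[ s ] b)
a ≤[ zero ]?  b = a ℤ.≤? b
a ≤[ suc _ ]? b = b ℤ.≤? a

≤-geodesic : ∀ {a b c} → a ℤ.≤ b → b ℤ.≤ c → ℤ.∣ a ℤ.- c ∣ ≡ ℤ.∣ a ℤ.- b ∣ + ℤ.∣ b ℤ.- c ∣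
≤-geodesic {a} {b} {c} a≤b b≤c = ℤₚ.+-injective (begin
  + ℤ.∣ a ℤ.- c ∣                          ≡⟨ ℤₚ.∣-∣-≤ (ℤₚ.≤-trans a≤b b≤c) ⟩
  c ℤ.- a                                  ≡⟨ telescope a b c ⟩
  (b ℤ.- a) ℤ.+ (c ℤ.- b)                  ≡⟨ cong₂ ℤ._+_ (ℤₚ.∣-∣-≤ a≤b) (ℤₚ.∣-∣-≤ b≤c) ⟨
  + (ℤ.∣ a ℤ.- b ∣ + ℤ.∣ b ℤ.- c ∣)        ∎)
  where
  open ≡-Reasoning
  telescope : ∀ a b c → c ℤ.- a ≡ (b ℤ.- a) ℤ.+ (c ℤ.- b)
  telescope = solve-∀

≤[]-geodesic : ∀ s {a b c} → a ≤[ s ] b → b ≤[ s ] c → ℤ.∣ a ℤ.- c ∣ ≡ ℤ.∣ a ℤ.- b ∣ + ℤ.∣ b ℤ.- c ∣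
≤[]-geodesic zero    a≤b b≤c = ≤-geodesic a≤b b≤c
≤[]-geodesic (suc _) {a} {b} {c} b≤a c≤b = begin
  ℤ.∣ a ℤ.- c ∣                    ≡⟨ ℤₚ.∣i-j∣≡∣j-i∣ a c ⟩
  ℤ.∣ c ℤ.- a ∣                    ≡⟨ ≤-geodesic c≤b b≤a ⟩
  ℤ.∣ c ℤ.- b ∣ + ℤ.∣ b ℤ.- a ∣    ≡⟨ ℕₚ.+-comm ℤ.∣ c ℤ.- b ∣ _ ⟩
  ℤ.∣ b ℤ.- a ∣ + ℤ.∣ c ℤ.- b ∣    ≡⟨ cong₂ _+_ (ℤₚ.∣i-j∣≡∣j-i∣ b a) (ℤₚ.∣i-j∣≡∣j-i∣ c b) ⟩
  ℤ.∣ a ℤ.- b ∣ + ℤ.∣ b ℤ.- c ∣    ∎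
  where open ≡-Reasoning

≤[]-antisym : ∀ s {a b} → a ≤[ s ] b → b ≤[ s ] a → a ≡ b
≤[]-antisym zero    a≤b b≤a = ℤₚ.≤-antisym a≤b b≤a
≤[]-antisym (suc _) b≤a a≤b = ℤₚ.≤-antisym a≤b b≤a

direction : ℤ → ℤ → Fin 2
direction a b = indicator (¬? (a ℤ.≤? b))

≤[direction] : ∀ a b → a ≤[ direction a b ] b
≤[direction] a b with a ℤ.≤? b
... | yes a≤b = a≤b
... | no  a≰b = ℤₚ.<⇒≤ (ℤₚ.≰⇒> a≰b)

_≼[_]_ : ∀ {n} → Point n → (Fin n → Fin 2) → Point n → Set
x ≼[ σ ] y = ∀ i → Vec.lookup x i ≤[ σ i ] Vec.lookup y i

≼? : ∀ {n} σ (x y : Point n) → Dec (x ≼[ σ ] y)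
≼? σ x y = Finₚ.all? λ i → Vec.lookup x i ≤[ σ i ]? Vec.lookup y i

≼-geodesic : ∀ {n} σ (x y z : Point n) → x ≼[ σ ] y → y ≼[ σ ] z → dist x z ≡ dist x y + dist y z
≼-geodesic σ [] [] [] _ _ = refl
≼-geodesic σ (a ∷ x) (b ∷ y) (c ∷ z) x≼y y≼z = trans
  (cong₂ _+_ (≤[]-geodesic (σ zero) (x≼y zero) (y≼z zero))
             (≼-geodesic (σ ∘ suc) x y z (x≼y ∘ suc) (y≼z ∘ suc)))
  (interchange ℤ.∣ a ℤ.- b ∣ ℤ.∣ b ℤ.- c ∣ (dist x y) (dist y z))

≼-antisym : ∀ {n} σ (x y : Point n) → x ≼[ σ ] y → y ≼[ σ ] x → x ≡ y
≼-antisym σ [] [] _ _ = refl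
≼-antisym σ (a ∷ x) (b ∷ y) x≼y y≼x =
  cong₂ _∷_ (≤[]-antisym (σ zero) (x≼y zero) (y≼x zero))
            (≼-antisym (σ ∘ suc) x y (x≼y ∘ suc) (y≼x ∘ suc))

-- Reversing all signs reverses the order, so fixing the first coordinate to increase
-- loses no comparabilities and leaves 2^m orders on ℤ^(m+1).
orthant : ∀ {m} → Fin (2 ^ m) → Fin (suc m) → Fin 2
orthant c zero    = zero
orthant c (suc i) = finToFun c i

≼[orthant] : ∀ {m} (x y : Point (suc m)) → Vec.lookup x zero ℤ.≤ Vec.lookup y zero →
             x ≼[ orthant (funToFin λ i → direction (Vec.lookup x (suc i)) (Vec.lookup y (suc i))) ] y
≼[orthant] x y x₀≤y₀ zero    = x₀≤y₀
≼[orthant] x y _     (suc i) =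
  subst (λ s → Vec.lookup x (suc i) ≤[ s ] Vec.lookup y (suc i))
        (sym (Finₚ.finToFun-funToFin _ i)) (≤[direction] _ _)

orthant-comparable : ∀ {m} (x y : Point (suc m)) → ∃[ c ] (x ≼[ orthant c ] y ⊎ y ≼[ orthant c ] x)
orthant-comparable x y with Vec.lookup x zero ℤ.≤? Vec.lookup y zero
... | yes x₀≤y₀ = _ , inj₁ (≼[orthant] x y x₀≤y₀)
... | no  x₀≰y₀ = _ , inj₂ (≼[orthant] y x (ℤₚ.<⇒≤ (ℤₚ.≰⇒> x₀≰y₀)))

lookup-injective : ∀ {A : Set} {xs : List A} → Unique xs → Injective _≡_ _≡_ (List.lookup xs)
lookup-injective (_  ∷ _) {zero}  {zero}  _  = refl
lookup-injective (x≢ ∷ _) {zero}  {suc j} eq = contradiction eq (All.lookup x≢ (∈-lookup j))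
lookup-injective (x≢ ∷ _) {suc i} {zero}  eq = contradiction (sym eq) (All.lookup x≢ (∈-lookup i))
lookup-injective (_  ∷ u) {suc i} {suc j} eq = cong suc (lookup-injective u eq)

generalPosition-upperBound : ∀ {m} (S : Point (suc m) → Set) → IsGPSet S →
                             ∀ xs → Unique xs → All S xs → length xs ≤ 2 ^ 2 ^ m
generalPosition-upperBound {m} S gp xs unique allS =
  chainFreeCover⇒≤2^ R (λ c i j → ≼? (orthant c) (p i) (p j)) chainFree
    (λ {i} {j} _ → orthant-comparable (p i) (p j))
  where
  p : Fin (length xs) → Point (suc m)
  p = List.lookup xs

  p-injective : Injective _≡_ _≡_ p
  p-injective = lookup-injective unique

  S∋p : ∀ i → S (p i)
  S∋p i = All.lookup allS (∈-lookup i)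

  R : Fin (2 ^ m) → Rel (Fin (length xs)) 0ℓ
  R c i j = p i ≼[ orthant c ] p j

  chainFree : ∀ c → ChainFree (R c)
  chainFree c {i} {j} {k} i≢j j≢k pi≼pj pj≼pk with i Finₚ.≟ k
  ... | yes refl = i≢j (p-injective (≼-antisym (orthant c) (p i) (p j) pi≼pj pj≼pk))
  ... | no  i≢k  = gp (p i) (p k) (p j) (S∋p i) (S∋p k) (S∋p j)
    (i≢k ∘ p-injective) (i≢j ∘ p-injective) (j≢k ∘ sym ∘ p-injective)
    (≼-geodesic (orthant c) (p i) (p j) (p k) pi≼pj pj≼pk)

Between : ℕ → ℕ → ℕ → Set
Between a b c = (a ≤ b × b ≤ c) ⊎ (c ≤ b × b ≤ a)

Between-sym : ∀ {a b c} → Between a b c → Between c b a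
Between-sym = Sum.swap

Between-suc : ∀ {a b c} → Between a b c → Between (suc a) (suc b) (suc c)
Between-suc = Sum.map (Product.map s≤s s≤s) (Product.map s≤s s≤s)

Between-same : ∀ {a b} → Between a b a → b ≡ a
Between-same (inj₁ (a≤b , b≤a)) = ℕₚ.≤-antisym b≤a a≤b
Between-same (inj₂ (a≤b , b≤a)) = ℕₚ.≤-antisym b≤a a≤b

∣-∣-additive⇒Between : ∀ a b c → ∣ a - c ∣ ≡ ∣ a - b ∣ + ∣ b - c ∣ → Between a b c
∣-∣-additive⇒Between zero    b       c       eq = inj₁ (z≤n , subst (b ≤_) (sym eq) (ℕₚ.m≤m+n b _))
∣-∣-additive⇒Between (suc a) zero    zero    _  = inj₂ (z≤n , z≤n)
∣-∣-additive⇒Between (suc a) (suc b) zero    eq = inj₂ (z≤n , subst (suc b ≤_) (sym eq) (ℕₚ.m≤n+m (suc b) _))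
∣-∣-additive⇒Between (suc a) zero    (suc c) eq = contradiction eq (ℕₚ.<⇒≢ ∣a-c∣<2+a+c)
  where
  ∣a-c∣<2+a+c : ∣ a - c ∣ < suc a + suc c
  ∣a-c∣<2+a+c = ℕₚ.≤-<-trans (ℕₚ.≤-trans (ℕₚ.∣m-n∣≤m⊔n a c) (ℕₚ.m⊔n≤m+n a c))
                              (ℕₚ.+-mono-< (ℕₚ.n<1+n a) (ℕₚ.n<1+n c))
∣-∣-additive⇒Between (suc a) (suc b) (suc c) eq = Between-suc (∣-∣-additive⇒Between a b c eq)

Betweenᵛ : ∀ {n} → Vector ℕ n → Vector ℕ n → Vector ℕ n → Set
Betweenᵛ u v w = ∀ t → Between (u t) (v t) (w t)

distℕ : ∀ {n} → Vector ℕ n → Vector ℕ n → ℕ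
distℕ {zero}  _ _ = 0
distℕ {suc n} u v = ∣ head u - head v ∣ + distℕ (tail u) (tail v)

distℕ-triangle : ∀ {n} (u v w : Vector ℕ n) → distℕ u w ≤ distℕ u v + distℕ v w
distℕ-triangle {zero}  _ _ _ = z≤n
distℕ-triangle {suc n} u v w = ℕₚ.≤-trans
  (ℕₚ.+-mono-≤ (ℕₚ.∣-∣-triangle (head u) (head v) (head w)) (distℕ-triangle (tail u) (tail v) (tail w)))
  (ℕₚ.≤-reflexive (interchange ∣ head u - head v ∣ ∣ head v - head w ∣ _ _))

≤∧≤∧+≡+⇒≡∧≡ : ∀ {a b c d} → a ≤ c → b ≤ d → a + b ≡ c + d → a ≡ c × b ≡ d
≤∧≤∧+≡+⇒≡∧≡ {a} {b} {c} {d} a≤c b≤d eq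
  with ℕₚ.≤-antisym a≤c (ℕₚ.≮⇒≥ λ a<c → ℕₚ.<⇒≢ (ℕₚ.+-mono-<-≤ a<c b≤d) eq)
... | refl = refl , ℕₚ.+-cancelˡ-≡ a b d eq

distℕ-additive⇒Betweenᵛ : ∀ {n} (u v w : Vector ℕ n) → distℕ u w ≡ distℕ u v + distℕ v w → Betweenᵛ u v w
distℕ-additive⇒Betweenᵛ {suc n} u v w eq = λ
  { zero    → ∣-∣-additive⇒Between (head u) (head v) (head w) (proj₁ split)
  ; (suc t) → distℕ-additive⇒Betweenᵛ (tail u) (tail v) (tail w) (proj₂ split) t
  }
  where
  split : ∣ head u - head w ∣ ≡ ∣ head u - head v ∣ + ∣ head v - head w ∣
        × distℕ (tail u) (tail w) ≡ distℕ (tail u) (tail v) + distℕ (tail v) (tail w)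
  split = ≤∧≤∧+≡+⇒≡∧≡ (ℕₚ.∣-∣-triangle (head u) (head v) (head w))
                      (distℕ-triangle (tail u) (tail v) (tail w))
                      (trans eq (interchange ∣ head u - head v ∣ (distℕ (tail u) (tail v)) _ _))

digits-< : ∀ B {a b} → a < B → b < B → B * a + b < B * B
digits-< B {a} {b} a<B b<B = begin-strict
  B * a + b  <⟨ ℕₚ.+-monoʳ-< (B * a) b<B ⟩
  B * a + B  ≡⟨ ℕₚ.+-comm (B * a) B ⟩
  B + B * a  ≡⟨ ℕₚ.*-suc B a ⟨
  B * suc a  ≤⟨ ℕₚ.*-monoʳ-≤ B a<B ⟩
  B * B      ∎
  where open ℕₚ.≤-Reasoning

highDigit-< : ∀ B {a b c} d → a < c → b < B → B * a + b < B * c + d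
highDigit-< B {a} {b} {c} d a<c b<B = begin-strict
  B * a + b      <⟨ ℕₚ.+-monoʳ-< (B * a) b<B ⟩
  B * a + B      ≡⟨ ℕₚ.+-comm (B * a) B ⟩
  B + B * a      ≡⟨ ℕₚ.*-suc B a ⟨
  B * suc a      ≤⟨ ℕₚ.*-monoʳ-≤ B a<c ⟩
  B * c          ≤⟨ ℕₚ.m≤m+n (B * c) d ⟩
  B * c + d      ∎
  where open ℕₚ.≤-Reasoning

highDigit-≤ : ∀ B {a b c d} → d < B → B * a + b ≤ B * c + d → a ≤ c
highDigit-≤ B {b = b} d<B le = ℕₚ.≮⇒≥ λ c<a → ℕₚ.<⇒≱ (highDigit-< B b c<a d<B) le

digits-injective : ∀ B {a b c d} → b < B → d < B → B * a + b ≡ B * c + d → a ≡ c × b ≡ d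
digits-injective B {a} {b} {c} {d} b<B d<B eq
  with ℕₚ.≤-antisym (highDigit-≤ B d<B (ℕₚ.≤-reflexive eq)) (highDigit-≤ B b<B (ℕₚ.≤-reflexive (sym eq)))
... | refl = refl , ℕₚ.+-cancelˡ-≡ (B * a) b d eq

reflect : ℕ → ℕ → ℕ
reflect B b = B ∸ suc b

reflect-< : ∀ B {b} → b < B → reflect B b < B
reflect-< B b<B = ℕₚ.∸-monoʳ-< z<s b<B

reflect-≤⇒≥ : ∀ B {b d} → d < B → reflect B b ≤ reflect B d → d ≤ b
reflect-≤⇒≥ B d<B le = ℕₚ.≮⇒≥ λ b<d → ℕₚ.<⇒≱ (ℕₚ.∸-monoʳ-< (s≤s b<d) d<B) le

reflect-injective : ∀ B {b d} → b < B → d < B → reflect B b ≡ reflect B d → b ≡ d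
reflect-injective B b<B d<B eq = ℕₚ.suc-injective (ℕₚ.∸-cancelˡ-≡ b<B d<B eq)

Between-highDigits : ∀ B {a b c x y z} → x < B → y < B → z < B →
                     Between (B * a + x) (B * b + y) (B * c + z) → Between a b c
Between-highDigits B x<B y<B z<B (inj₁ (≤₁ , ≤₂)) = inj₁ (highDigit-≤ B y<B ≤₁ , highDigit-≤ B z<B ≤₂)
Between-highDigits B x<B y<B z<B (inj₂ (≤₁ , ≤₂)) = inj₂ (highDigit-≤ B y<B ≤₁ , highDigit-≤ B x<B ≤₂)

Between-lowDigits : ∀ B a {x y z} → Between (B * a + x) (B * a + y) (B * a + z) → Between x y z
Between-lowDigits B a = Sum.map (Product.map cancel cancel) (Product.map cancel cancel)
  where
  cancel : ∀ {m n} → B * a + m ≤ B * a + n → m ≤ n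
  cancel = ℕₚ.+-cancelˡ-≤ (B * a) _ _

Between-sameRow-≤ : ∀ B {a c x y z} → a < c → y < B →
                    Between (B * a + x) (B * a + y) (B * c + z) → x ≤ y
Between-sameRow-≤ B _ _ (inj₁ (≤₁ , _)) = ℕₚ.+-cancelˡ-≤ _ _ _ ≤₁
Between-sameRow-≤ B {z = z} a<c y<B (inj₂ (≤₁ , _)) = contradiction ≤₁ (ℕₚ.<⇒≱ (highDigit-< B z a<c y<B))

Between-sameRow-≥ : ∀ B {a c x y z} → c < a → z < B →
                    Between (B * a + x) (B * a + y) (B * c + z) → y ≤ x
Between-sameRow-≥ B {y = y} c<a z<B (inj₁ (_ , ≤₂)) = contradiction ≤₂ (ℕₚ.<⇒≱ (highDigit-< B y c<a z<B))
Between-sameRow-≥ B _ _ (inj₂ (_ , ≤₂)) = ℕₚ.+-cancelˡ-≤ _ _ _ ≤₂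

-- Moving within one row towards a point of another row moves the low digit in a fixed
-- direction; the reflected digit moves in the opposite one, so it cannot move at all.
reflectedDigits-sameRow-≡ : ∀ B {a c x y z} → a ≢ c → x < B → y < B → z < B →
  Between (B * a + x) (B * a + y) (B * c + z) →
  Between (B * a + reflect B x) (B * a + reflect B y) (B * c + reflect B z) → x ≡ y
reflectedDigits-sameRow-≡ B {a} {c} a≢c x<B y<B z<B btw btwʳ with ℕₚ.<-cmp a c
... | tri< a<c _ _ = ℕₚ.≤-antisym (Between-sameRow-≤ B a<c y<B btw)
                       (reflect-≤⇒≥ B y<B (Between-sameRow-≤ B a<c (reflect-< B y<B) btwʳ))
... | tri≈ _ a≡c _ = contradiction a≡c a≢c
... | tri> _ _ c<a = ℕₚ.≤-antisym (reflect-≤⇒≥ B x<B (Between-sameRow-≥ B c<a (reflect-< B z<B) btwʳ))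
                       (Between-sameRow-≥ B c<a z<B btw)

InGeneralPosition : ∀ {I : Set} {n} → (I → Vector ℕ n) → Set
InGeneralPosition f = ∀ {i j k} → i ≢ j → i ≢ k → j ≢ k → ¬ Betweenᵛ (f i) (f j) (f k)

record IsConfiguration {I : Set} {k} (B : ℕ) (f : I → Vector ℕ (suc k)) : Set where
  field
    bounded         : ∀ i t → f i t < B
    head-injective  : Injective _≡_ _≡_ (head ∘ f)
    generalPosition : InGeneralPosition f

IsConfiguration-reindex : ∀ {I J : Set} {k B} {f : I → Vector ℕ (suc k)} {g : J → I} →
                          IsConfiguration B f → Injective _≡_ _≡_ g → IsConfiguration B (f ∘ g)
IsConfiguration-reindex conf g-injective = record
  { bounded         = bounded ∘ _
  ; head-injective  = g-injective ∘ head-injective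
  ; generalPosition = λ i≢j i≢k j≢k →
      generalPosition (i≢j ∘ g-injective) (i≢k ∘ g-injective) (j≢k ∘ g-injective)
  }
  where open IsConfiguration conf

pairUp : ∀ {n k} → ℕ → (Fin n → Vector ℕ (suc k)) → Fin n × Fin n → Vector ℕ (suc (suc k))
pairUp B f (a , b) zero    = B * head (f a) + reflect B (head (f b))
pairUp B f (a , b) (suc t) = B * f a t + f b t

module _ {n k B} {f : Fin n → Vector ℕ (suc k)} (conf : IsConfiguration B f) where
  open IsConfiguration conf

  private
    sameRow⇒sameColumn : ∀ {a c b₁ b₂ b₃} → a ≢ c →
      Betweenᵛ (pairUp B f (a , b₁)) (pairUp B f (a , b₂)) (pairUp B f (c , b₃)) → b₁ ≡ b₂
    sameRow⇒sameColumn a≢c btw = head-injective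
      (reflectedDigits-sameRow-≡ B (a≢c ∘ head-injective)
        (bounded _ zero) (bounded _ zero) (bounded _ zero) (btw (suc zero)) (btw zero))

    highDigits : ∀ {a₁ a₂ a₃ b₁ b₂ b₃} →
      Betweenᵛ (pairUp B f (a₁ , b₁)) (pairUp B f (a₂ , b₂)) (pairUp B f (a₃ , b₃)) →
      Betweenᵛ (f a₁) (f a₂) (f a₃)
    highDigits btw t = Between-highDigits B (bounded _ t) (bounded _ t) (bounded _ t) (btw (suc t))

    lowDigits : ∀ {a b₁ b₂ b₃} →
      Betweenᵛ (pairUp B f (a , b₁)) (pairUp B f (a , b₂)) (pairUp B f (a , b₃)) →
      Betweenᵛ (f b₁) (f b₂) (f b₃)
    lowDigits {a} btw t = Between-lowDigits B (f a t) (btw (suc t))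

    pairUp-generalPosition : InGeneralPosition (pairUp B f)
    pairUp-generalPosition {a₁ , b₁} {a₂ , b₂} {a₃ , b₃} ≢₁₂ ≢₁₃ ≢₂₃ btw
      with a₁ Finₚ.≟ a₂ | a₂ Finₚ.≟ a₃ | a₁ Finₚ.≟ a₃
    ... | yes refl | yes refl | _ =
      generalPosition (≢₁₂ ∘ cong (a₁ ,_)) (≢₁₃ ∘ cong (a₁ ,_)) (≢₂₃ ∘ cong (a₁ ,_)) (lowDigits btw)
    ... | yes refl | no a₂≢a₃ | _ = ≢₁₂ (cong (a₁ ,_) (sameRow⇒sameColumn a₂≢a₃ btw))
    ... | no a₁≢a₂ | yes refl | _ =
      ≢₂₃ (cong (a₂ ,_) (sym (sameRow⇒sameColumn (a₁≢a₂ ∘ sym) (Between-sym ∘ btw))))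
    ... | no a₁≢a₂ | no _ | yes refl = a₁≢a₂ (sym (head-injective (Between-same (highDigits btw zero))))
    ... | no a₁≢a₂ | no a₂≢a₃ | no a₁≢a₃ = generalPosition a₁≢a₂ a₁≢a₃ a₂≢a₃ (highDigits btw)

  pairUp-isConfiguration : IsConfiguration (B * B) (pairUp B f)
  pairUp-isConfiguration = record
    { bounded         = λ
      { (a , b) zero    → digits-< B (bounded a zero) (reflect-< B (bounded b zero))
      ; (a , b) (suc t) → digits-< B (bounded a t) (bounded b t)
      }
    ; head-injective  = λ {(a , b)} {(c , d)} eq →
        let high≡ , low≡ =
              digits-injective B (reflect-< B (bounded b zero)) (reflect-< B (bounded d zero)) eq
        in cong₂ _,_ (head-injective high≡)
                     (head-injective (reflect-injective B (bounded b zero) (bounded d zero) low≡))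
    ; generalPosition = pairUp-generalPosition
    }

noThreeDistinct-Fin2 : ∀ {i j k : Fin 2} → i ≢ j → i ≢ k → j ≢ k → ⊥
noThreeDistinct-Fin2 {zero}     {zero}     i≢j _   _   = i≢j refl
noThreeDistinct-Fin2 {zero}     {suc zero} {zero}     _ i≢k _   = i≢k refl
noThreeDistinct-Fin2 {zero}     {suc zero} {suc zero} _ _   j≢k = j≢k refl
noThreeDistinct-Fin2 {suc zero} {zero}     {zero}     _ _   j≢k = j≢k refl
noThreeDistinct-Fin2 {suc zero} {zero}     {suc zero} _ i≢k _   = i≢k refl
noThreeDistinct-Fin2 {suc zero} {suc zero} i≢j _   _   = i≢j refl

size : ℕ → ℕ
size zero    = 2
size (suc m) = size m * size m

size≡2^2^ : ∀ m → size m ≡ 2 ^ 2 ^ m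
size≡2^2^ zero    = refl
size≡2^2^ (suc m) = begin
  size m * size m        ≡⟨ cong₂ _*_ (size≡2^2^ m) (size≡2^2^ m) ⟩
  2 ^ 2 ^ m * 2 ^ 2 ^ m  ≡⟨ ℕₚ.^-distribˡ-+-* 2 (2 ^ m) (2 ^ m) ⟨
  2 ^ (2 ^ m + 2 ^ m)    ≡⟨ cong (λ e → 2 ^ (2 ^ m + e)) (ℕₚ.+-identityʳ (2 ^ m)) ⟨
  2 ^ 2 ^ suc m          ∎
  where open ≡-Reasoning

configuration : ∀ m → Fin (size m) → Vector ℕ (suc m)
configuration zero    i _ = toℕ i
configuration (suc m)     = pairUp (size m) (configuration m) ∘ remQuot (size m)

remQuot-injective : ∀ {m} n → Injective _≡_ _≡_ (remQuot {m} n)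
remQuot-injective {m} n {i} {j} eq = begin
  i                                           ≡⟨ Finₚ.combine-remQuot {m} n i ⟨
  Product.uncurry combine (remQuot {m} n i)   ≡⟨ cong (Product.uncurry combine) eq ⟩
  Product.uncurry combine (remQuot {m} n j)   ≡⟨ Finₚ.combine-remQuot {m} n j ⟩
  j                                           ∎
  where open ≡-Reasoning

configuration-isConfiguration : ∀ m → IsConfiguration (size m) (configuration m)
configuration-isConfiguration zero = record
  { bounded         = λ i _ → Finₚ.toℕ<n i
  ; head-injective  = Finₚ.toℕ-injective
  ; generalPosition = λ i≢j i≢k j≢k _ → noThreeDistinct-Fin2 i≢j i≢k j≢k
  }
configuration-isConfiguration (suc m) = IsConfiguration-reindex
  (pairUp-isConfiguration (configuration-isConfiguration m)) (remQuot-injective (size m))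

toPoint : ∀ {n} → Vector ℕ n → Point n
toPoint u = Vec.tabulate (+_ ∘ u)

∣+m-+n∣≡∣m-n∣ : ∀ m n → ℤ.∣ + m ℤ.- + n ∣ ≡ ∣ m - n ∣
∣+m-+n∣≡∣m-n∣ m n with ℕₚ.≤-total m n | ℤₚ.[+m]-[+n]≡m⊖n m n
... | inj₁ m≤n | eq = trans (cong ℤ.∣_∣ eq) (trans (ℤₚ.∣⊖∣-≤ m≤n) (sym (ℕₚ.m≤n⇒∣m-n∣≡n∸m m≤n)))
... | inj₂ n≤m | eq = trans (cong ℤ.∣_∣ eq)
  (trans (ℤₚ.∣m⊖n∣≡∣n⊖m∣ m n) (trans (ℤₚ.∣⊖∣-≤ n≤m) (sym (ℕₚ.m≤n⇒∣n-m∣≡n∸m n≤m))))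

dist-toPoint : ∀ {n} (u v : Vector ℕ n) → dist (toPoint u) (toPoint v) ≡ distℕ u v
dist-toPoint {zero}  _ _ = refl
dist-toPoint {suc n} u v = cong₂ _+_ (∣+m-+n∣≡∣m-n∣ (head u) (head v)) (dist-toPoint (tail u) (tail v))

points : ∀ {n k} → (Fin n → Vector ℕ k) → List (Point k)
points f = List.tabulate (toPoint ∘ f)

points-unique : ∀ {n k} {f : Fin n → Vector ℕ (suc k)} → Injective _≡_ _≡_ (head ∘ f) → Unique (points f)
points-unique head-injective = tabulate⁺ (head-injective ∘ ℤₚ.+-injective ∘ cong Vec.head)

points-isGPSet : ∀ {n k} {f : Fin n → Vector ℕ k} → InGeneralPosition f → IsGPSet (_∈ points f)
points-isGPSet {f = f} gp u v w u∈ v∈ w∈ u≢v u≢w v≢w additive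
  with ∈-tabulate⁻ u∈ | ∈-tabulate⁻ v∈ | ∈-tabulate⁻ w∈
... | i , refl | k , refl | j , refl =
  gp (u≢w ∘ cong (toPoint ∘ f)) (u≢v ∘ cong (toPoint ∘ f)) (v≢w ∘ cong (toPoint ∘ f) ∘ sym)
     (distℕ-additive⇒Betweenᵛ (f i) (f j) (f k) (begin
       distℕ (f i) (f k)                          ≡⟨ dist-toPoint (f i) (f k) ⟨
       dist (toPoint (f i)) (toPoint (f k))       ≡⟨ additive ⟩
       dist (toPoint (f i)) (toPoint (f j)) + dist (toPoint (f j)) (toPoint (f k))
         ≡⟨ cong₂ _+_ (dist-toPoint (f i) (f j)) (dist-toPoint (f j) (f k)) ⟩
       distℕ (f i) (f j) + distℕ (f j) (f k)      ∎))
  where open ≡-Reasoning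

theorem1 : ∀ (n : ℕ) → 1 ≤ n → GPNumberIs n (2 ^ (2 ^ (n ∸ 1)))
theorem1 (suc m) _ =
  ( points (configuration m)
  , points-unique {f = configuration m} head-injective
  , points-isGPSet generalPosition
  , trans (length-tabulate (toPoint ∘ configuration m)) (size≡2^2^ m)
  ) , generalPosition-upperBound
  where open IsConfiguration (configuration-isConfiguration m)
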